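{- Let $P=(p_1,\dots,p_k)$ be a sequence of positive integers and let $M_1,\dots,M_t$ be pairwise disjoint blocks of consecutive positions in $[k]$ such that all positions within each $M_s$ carry the same value. If an $\mathrm{LS}(p_1\dots p_k)$ exists, then an $\mathrm{ROS}(P)$ exists which is similar with respect to each of $M_1,\dots,M_t$.
   Context: For positive integers $p_1,\dots,p_k$ with $n=\sum_i p_i$, an $\mathrm{LS}(p_1\dots p_k)$ is a latin square of order $n$ containing $k$ pairwise disjoint subsquares of orders $p_1,\dots,p_k$ (a subsquare is a square subarray which is itself a latin square; disjoint means sharing no rows, columns or symbols). An $\mathrm{ROS}(P)$ is an assignment of a non-negative rational number $X(i,j,\ell)$ to every multiset $\{i,j,\ell\}$ of elements of $[k]$ (invariant under permuting $i,j,\ell$) such that $\sum_{\ell\in[k]}X(i,j,\ell)=p_ip_j$ for all $i,j\in[k]$, and $X(i,i,i)=p_i^2$ and $X(i,i,j)=0$ for all $i\neq j$. If the positions of a block $M=\{a,\dots,a+m-1\}$ all carry the same part, $X$ is similar with respect to $M$ if there exist non-negative values $X'(i,j,a)$, $X'(i,a,a)$ (for $i,j\notin M$) and $X'(a,a,a)$ such that for all distinct $\alpha,\beta,\gamma\in M$ and all $i,j\notin M$: $X(i,j,\alpha)=X'(i,j,a)$, $X(i,\alpha,\beta)=X'(i,a,a)$, and $X(\alpha,\beta,\gamma)=X'(a,a,a)$. -}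

module Defs where

open import Data.Nat as ℕ using (ℕ; zero; suc)
open import Data.Fin using (Fin; toℕ; zero; suc)
open import Data.Fin.Subset using (Subset; _∈_; _∉_; ∣_∣)
open import Data.Vec using (tabulate)
open import Data.Product using (Σ; _×_; ∃; ∃-syntax)
open import Data.Integer using (+_)
open import Data.Rational using (ℚ; 0ℚ; _+_; _*_; _/_) renaming (_≤_ to _≤ℚ_)
open import Relation.Binary.PropositionalEquality using (_≡_; _≢_)
open import Relation.Nullary using (¬_)
open import Data.Empty using (⊥)

sumℕ : ∀ {k} → (Fin k → ℕ) → ℕ
sumℕ f = Data.Vec.sum (tabulate f)

sumℚ : ∀ {k} → (Fin k → ℚ) → ℚ
sumℚ {zero} f = 0ℚ
sumℚ {suc k} f = f zero + sumℚ (λ i → f (suc i))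

ℕ→ℚ : ℕ → ℚ
ℕ→ℚ n = (+ n) / 1

IsLatinSquare : ∀ {n} → (Fin n → Fin n → Fin n) → Set
IsLatinSquare {n} L =
  (∀ r (s : Fin n) → Σ (Fin n) λ c → (L r c ≡ s) × (∀ c' → L r c' ≡ s → c' ≡ c)) ×
  (∀ c (s : Fin n) → Σ (Fin n) λ r → (L r c ≡ s) × (∀ r' → L r' c ≡ s → r' ≡ r))

IsSubsquare : ∀ {n} → (Fin n → Fin n → Fin n) → ℕ →
              Subset n → Subset n → Subset n → Set
IsSubsquare {n} L m R C S =
  (∣ R ∣ ≡ m) × (∣ C ∣ ≡ m) × (∣ S ∣ ≡ m) ×
  (∀ r c → r ∈ R → c ∈ C → L r c ∈ S) ×
  (∀ r s → r ∈ R → s ∈ S →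
     Σ (Fin n) λ c → (c ∈ C) × (L r c ≡ s) ×
       (∀ c' → c' ∈ C → L r c' ≡ s → c' ≡ c)) ×
  (∀ c s → c ∈ C → s ∈ S →
     Σ (Fin n) λ r → (r ∈ R) × (L r c ≡ s) ×
       (∀ r' → r' ∈ R → L r' c ≡ s → r' ≡ r))

DisjointSets : ∀ {n} → Subset n → Subset n → Set
DisjointSets {n} A B = ∀ (x : Fin n) → x ∈ A → x ∈ B → ⊥

LS : ∀ {k} → (Fin k → ℕ) → Set
LS {k} p =
  Σ (Fin (sumℕ p) → Fin (sumℕ p) → Fin (sumℕ p)) λ L →
  IsLatinSquare L ×
  Σ (Fin k → Subset (sumℕ p)) λ R →
  Σ (Fin k → Subset (sumℕ p)) λ C →
  Σ (Fin k → Subset (sumℕ p)) λ S →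
    (∀ i → IsSubsquare L (p i) (R i) (C i) (S i)) ×
    (∀ i j → i ≢ j →
       DisjointSets (R i) (R j) × DisjointSets (C i) (C j) × DisjointSets (S i) (S j))

-- X is invariant under all permutations of its three arguments, i.e. it
-- is a function on multisets {i,j,ℓ}.
Symmetric3 : ∀ {k} → (Fin k → Fin k → Fin k → ℚ) → Set
Symmetric3 X = ∀ i j l → (X i j l ≡ X j i l) × (X i j l ≡ X i l j)

IsROS : ∀ {k} → (Fin k → ℕ) → (Fin k → Fin k → Fin k → ℚ) → Set
IsROS {k} p X =
  Symmetric3 X ×
  (∀ i j l → 0ℚ ≤ℚ X i j l) ×
  (∀ i j → sumℚ (λ l → X i j l) ≡ ℕ→ℚ (p i ℕ.* p j)) ×
  (∀ i → X i i i ≡ ℕ→ℚ (p i ℕ.* p i)) ×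
  (∀ i j → i ≢ j → X i i j ≡ 0ℚ)

InBlock : ∀ {k} → ℕ → ℕ → Fin k → Set
InBlock a m x = (a ℕ.≤ toℕ x) × (toℕ x ℕ.< a ℕ.+ m)

SimilarWrt : ∀ {k} → (Fin k → Fin k → Fin k → ℚ) → (Fin k → Set) → Set
SimilarWrt {k} X M =
  Σ (Fin k → Fin k → ℚ) λ Y₁ →
  Σ (Fin k → ℚ) λ Y₂ →
  Σ ℚ λ Y₃ →
    (∀ i j → 0ℚ ≤ℚ Y₁ i j) × (∀ i → 0ℚ ≤ℚ Y₂ i) × (0ℚ ≤ℚ Y₃) ×
    (∀ i j α → ¬ M i → ¬ M j → M α → X i j α ≡ Y₁ i j) ×
    (∀ i α β → ¬ M i → M α → M β → α ≢ β → X i α β ≡ Y₂ i) ×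
    (∀ α β γ → M α → M β → M γ → α ≢ β → α ≢ γ → β ≢ γ → X α β γ ≡ Y₃)

-- Let X₀(i, j, l) count the cells of the latin square whose row lies in the i-th subsquare,
-- whose column lies in the j-th one and whose symbol lies in the l-th one. The subsquares
-- partition rows, columns and symbols, and every row and column of a latin square is a
-- permutation of the symbols, so each line sum of X₀ is pᵢpⱼ; the subsquare property makes
-- entries with exactly two equal indices vanish. Summing X₀ over the six permutations of its
-- coordinates makes it symmetric, and summing the result over all permutations of [k] that
-- preserve P makes it invariant under every transposition of two positions carrying the same
-- part. Divided by its total multiplicity this is an ROS(P). Inside a block M, a product of
-- at most three such transpositions carries any triple of distinct elements of M to any other
-- while fixing the positions outside M, which is exactly similarity with respect to M.
module Submission where

open import Defs
open import Data.Nat as ℕ using (ℕ; zero; suc; _+_; _*_; _^_; _≤_; z≤n; s≤s; NonZero; _≤?_; _<?_)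
import Data.Nat.Properties as ℕ
open import Data.Nat.Tactic.RingSolver using (solve-∀)
open import Data.Integer as ℤ using (+_)
import Data.Integer.Properties as ℤ
open import Data.Rational as ℚ using (ℚ; 0ℚ; _/_; fromℚᵘ)
import Data.Rational.Properties as ℚ
open import Data.Rational.Unnormalised as ℚᵘ using (mkℚᵘ; *≡*)
import Data.Rational.Unnormalised.Properties as ℚᵘ
open import Data.Fin using (Fin; zero; suc; toℕ; _≟_; punchIn; finToFun; funToFin; combine)
open import Data.Fin.Properties using (all?; any?; punchInᵢ≢i; funToFin-finToFin; finToFun-funToFin)
open import Data.Fin.Subset using (Subset; _∈_; ∣_∣; inside; outside)
open import Data.Fin.Subset.Properties using (_∈?_)
open import Data.Fin.Permutation using (permutation)
open import Data.Fin.Permutation.Components using (transpose; transpose-inverse)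
open import Data.Vec using ([]; _∷_)
open import Data.Bool using (if_then_else_)
open import Data.Product using (Σ; _×_; _,_; ∃; proj₁; proj₂)
open import Data.Empty using (⊥; ⊥-elim)
open import Function using (_∘_; id; _$_)
open import Relation.Nullary using (Dec; yes; no; does; ¬_)
open import Relation.Nullary.Decidable using (_×-dec_; _→-dec_; ¬?; map′; dec-true; dec-false)
open import Relation.Unary using (Decidable)
open import Relation.Binary.PropositionalEquality
open import Algebra.Properties.Semiring.Sum ℕ.+-*-semiring
  using (sum; sum-cong-≗; sum-remove; sum-replicate-zero; ∑-comm; ∑-distrib-+; ∑-permute; *-distribˡ-sum; *-distribʳ-sum)

open ≡-Reasoning

χ : ∀ {P : Set} → Dec P → ℕ
χ d = if does d then 1 else 0

χ-false : ∀ {P : Set} (d : Dec P) → ¬ P → χ d ≡ 0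
χ-false (yes p) ¬p = ⊥-elim (¬p p)
χ-false (no _)  _  = refl

χ≤1 : ∀ {P : Set} (d : Dec P) → χ d ≤ 1
χ≤1 (yes _) = ℕ.≤-refl
χ≤1 (no _)  = z≤n

χ-cong : ∀ {P : Set} (d : Dec P) {x y} → (P → x ≡ y) → χ d * x ≡ χ d * y
χ-cong (yes p) x≡y = cong (1 *_) (x≡y p)
χ-cong (no _)  _   = refl

χ-⇔ : ∀ {P Q : Set} (d : Dec P) (e : Dec Q) → (P → Q) → (Q → P) → χ d ≡ χ e
χ-⇔ (yes _) (yes _) _   _   = refl
χ-⇔ (no _)  (no _)  _   _   = refl
χ-⇔ (yes p) (no ¬q) p⇒q _   = ⊥-elim (¬q (p⇒q p))
χ-⇔ (no ¬p) (yes q) _   q⇒p = ⊥-elim (¬p (q⇒p q))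

sumℕ≡sum : ∀ {k} (f : Fin k → ℕ) → sumℕ f ≡ sum f
sumℕ≡sum {zero}  f = refl
sumℕ≡sum {suc k} f = cong (f zero ℕ.+_) (sumℕ≡sum (f ∘ suc))

sum-zero : ∀ {n} (f : Fin n → ℕ) → (∀ x → f x ≡ 0) → sum f ≡ 0
sum-zero {n} f f≡0 = trans (sum-cong-≗ f≡0) (sum-replicate-zero n)

sum-single : ∀ {n} (f : Fin n → ℕ) i → (∀ j → j ≢ i → f j ≡ 0) → sum f ≡ f i
sum-single {suc n} f i others = begin
  sum f                             ≡⟨ sum-remove {i = i} f ⟩
  f i + sum (λ j → f (punchIn i j)) ≡⟨ cong (f i ℕ.+_) (sum-zero _ λ j → others _ (punchInᵢ≢i i j)) ⟩
  f i + 0                           ≡⟨ ℕ.+-identityʳ (f i) ⟩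
  f i                               ∎

term≤sum : ∀ {n} (f : Fin n → ℕ) i → f i ≤ sum f
term≤sum f zero    = ℕ.m≤m+n _ _
term≤sum f (suc i) = ℕ.≤-trans (term≤sum (f ∘ suc) i) (ℕ.m≤n+m _ _)

sum≤n : ∀ {n} (g : Fin n → ℕ) → (∀ x → g x ≤ 1) → sum g ≤ n
sum≤n {zero}  g g≤1 = z≤n
sum≤n {suc n} g g≤1 = ℕ.+-mono-≤ (g≤1 zero) (sum≤n (g ∘ suc) (g≤1 ∘ suc))

sum≡n⇒≡1 : ∀ {n} (g : Fin n → ℕ) → (∀ x → g x ≤ 1) → sum g ≡ n → ∀ x → g x ≡ 1
sum≡n⇒≡1 {suc n} g g≤1 Σg≡n x with g zero in g₀≡ | g≤1 zero | sum≤n (g ∘ suc) (g≤1 ∘ suc)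
... | zero     | _ | tail≤n = ⊥-elim (ℕ.<⇒≱ (ℕ.n<1+n n) (subst (_≤ n) Σg≡n tail≤n))
... | suc zero | _ | _ with x
...   | zero  = g₀≡
...   | suc y = sum≡n⇒≡1 (g ∘ suc) (g≤1 ∘ suc) (ℕ.suc-injective Σg≡n) y
sum≡n⇒≡1 {suc n} g g≤1 Σg≡n x | suc (suc _) | s≤s () | _

∑-comm₃ : ∀ {a b c} (f : Fin a → Fin b → Fin c → ℕ) →
          sum (λ x → sum λ y → sum λ z → f x y z) ≡ sum (λ y → sum λ z → sum λ x → f x y z)
∑-comm₃ f = trans (∑-comm (λ x y → sum λ z → f x y z)) (sum-cong-≗ λ y → ∑-comm (λ x z → f x y z))

sum-*ˡ : ∀ {n} x (u : Fin n → ℕ) → sum (λ r → x * u r) ≡ x * sum u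
sum-*ˡ x u = sym (*-distribˡ-sum x u)

sum-*ʳ : ∀ {n} (u : Fin n → ℕ) x → sum (λ r → u r * x) ≡ sum u * x
sum-*ʳ u x = sym (*-distribʳ-sum x u)

ind : ∀ {n} → Subset n → Fin n → ℕ
ind U x = χ (x ∈? U)

sum-ind : ∀ {n} (U : Subset n) → sum (ind U) ≡ ∣ U ∣
sum-ind []            = refl
sum-ind (inside  ∷ U) = cong suc (sum-ind U)
sum-ind (outside ∷ U) = sum-ind U

sum-ind-disjoint≤1 : ∀ {k n} (F : Fin k → Subset n) → (∀ l l′ → l ≢ l′ → DisjointSets (F l) (F l′)) →
                     ∀ x → sum (λ l → ind (F l) x) ≤ 1
sum-ind-disjoint≤1 F disjoint x with any? (λ l → x ∈? F l)
... | yes (l₀ , x∈F₀) = ℕ.≤-trans (ℕ.≤-reflexive (sum-single _ l₀ λ l l≢l₀ →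
                          χ-false (x ∈? F l) (λ x∈F → disjoint l l₀ l≢l₀ x x∈F x∈F₀)))
                        (χ≤1 (x ∈? F l₀))
... | no x∉⋃F = subst (_≤ 1) (sym (sum-zero _ λ l → χ-false (x ∈? F l) (λ x∈F → x∉⋃F (l , x∈F)))) z≤n

sum-ind-partition≡1 : ∀ {k n} (F : Fin k → Subset n) → (∀ l l′ → l ≢ l′ → DisjointSets (F l) (F l′)) →
                sum (λ l → ∣ F l ∣) ≡ n → ∀ x → sum (λ l → ind (F l) x) ≡ 1
sum-ind-partition≡1 {n = n} F disjoint total = sum≡n⇒≡1 _ (sum-ind-disjoint≤1 F disjoint) (begin
  sum (λ x → sum λ l → ind (F l) x) ≡⟨ ∑-comm (λ x l → ind (F l) x) ⟩
  sum (λ l → sum (ind (F l)))       ≡⟨ sum-cong-≗ (sum-ind ∘ F) ⟩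
  sum (λ l → ∣ F l ∣)               ≡⟨ total ⟩
  n                                 ∎)

module CellSum {n} (L : Fin n → Fin n → Fin n) (lat : IsLatinSquare L) where

  row-injective : ∀ r {c c′} → L r c ≡ L r c′ → c ≡ c′
  row-injective r {c} {c′} Lrc≡Lrc′ = trans (unique c Lrc≡Lrc′) (sym (unique c′ refl))
    where unique = proj₂ (proj₂ (proj₁ lat r (L r c′)))

  column-injective : ∀ c {r r′} → L r c ≡ L r′ c → r ≡ r′
  column-injective c {r} {r′} Lrc≡Lr′c = trans (unique r Lrc≡Lr′c) (sym (unique r′ refl))
    where unique = proj₂ (proj₂ (proj₂ lat c (L r′ c)))

  sum-row : ∀ r (w : Fin n → ℕ) → sum (λ c → w (L r c)) ≡ sum w
  sum-row r w = sym (∑-permute w (permutation (L r) (proj₁ ∘ entry) (proj₁ ∘ proj₂ ∘ entry)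
                                              (λ c → row-injective r (proj₁ (proj₂ (entry (L r c)))))))
    where entry = proj₁ lat r

  sum-column : ∀ c (w : Fin n → ℕ) → sum (λ r → w (L r c)) ≡ sum w
  sum-column c w = sym (∑-permute w (permutation (λ r → L r c) (proj₁ ∘ entry) (proj₁ ∘ proj₂ ∘ entry)
                                                 (λ r → column-injective c (proj₁ (proj₂ (entry (L r c)))))))
    where entry = proj₂ lat c

  cellSum : (Fin n → ℕ) → (Fin n → ℕ) → (Fin n → ℕ) → ℕ
  cellSum u v w = sum λ r → sum λ c → u r * (v c * w (L r c))

  cellSum-marginal₁ : ∀ {k} (u : Fin k → Fin n → ℕ) v w → (∀ r → sum (λ l → u l r) ≡ 1) →
                      sum (λ l → cellSum (u l) v w) ≡ sum v * sum w
  cellSum-marginal₁ u v w Σu≡1 = begin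
    sum (λ l → cellSum (u l) v w)                ≡⟨ ∑-comm₃ (λ l r c → u l r * (v c * w (L r c))) ⟩
    sum (λ r → sum λ c → sum λ l → u l r * (v c * w (L r c)))
      ≡⟨ sum-cong-≗ (λ r → sum-cong-≗ λ c → trans (sum-*ʳ (λ l → u l r) (v c * w (L r c)))
           (trans (cong (_* (v c * w (L r c))) (Σu≡1 r)) (ℕ.*-identityˡ _))) ⟩
    sum (λ r → sum λ c → v c * w (L r c))        ≡⟨ ∑-comm (λ r c → v c * w (L r c)) ⟩
    sum (λ c → sum λ r → v c * w (L r c))
      ≡⟨ sum-cong-≗ (λ c → trans (sum-*ˡ (v c) (λ r → w (L r c))) (cong (v c *_) (sum-column c w))) ⟩
    sum (λ c → v c * sum w)                      ≡⟨ sum-*ʳ v (sum w) ⟩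
    sum v * sum w                                ∎

  cellSum-marginal₂ : ∀ {k} u (v : Fin k → Fin n → ℕ) w → (∀ c → sum (λ l → v l c) ≡ 1) →
                      sum (λ l → cellSum u (v l) w) ≡ sum u * sum w
  cellSum-marginal₂ u v w Σv≡1 = begin
    sum (λ l → cellSum u (v l) w)                ≡⟨ ∑-comm₃ (λ l r c → u r * (v l c * w (L r c))) ⟩
    sum (λ r → sum λ c → sum λ l → u r * (v l c * w (L r c)))
      ≡⟨ sum-cong-≗ (λ r → sum-cong-≗ λ c → trans (sum-*ˡ (u r) (λ l → v l c * w (L r c))) (cong (u r *_)
           (trans (sum-*ʳ (λ l → v l c) (w (L r c))) (trans (cong (_* w (L r c)) (Σv≡1 c)) (ℕ.*-identityˡ _))))) ⟩
    sum (λ r → sum λ c → u r * w (L r c))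
      ≡⟨ sum-cong-≗ (λ r → trans (sum-*ˡ (u r) (λ c → w (L r c))) (cong (u r *_) (sum-row r w))) ⟩
    sum (λ r → u r * sum w)                      ≡⟨ sum-*ʳ u (sum w) ⟩
    sum u * sum w                                ∎

  cellSum-marginal₃ : ∀ {k} u v (w : Fin k → Fin n → ℕ) → (∀ s → sum (λ l → w l s) ≡ 1) →
                      sum (λ l → cellSum u v (w l)) ≡ sum u * sum v
  cellSum-marginal₃ u v w Σw≡1 = begin
    sum (λ l → cellSum u v (w l))                ≡⟨ ∑-comm₃ (λ l r c → u r * (v c * w l (L r c))) ⟩
    sum (λ r → sum λ c → sum λ l → u r * (v c * w l (L r c)))
      ≡⟨ sum-cong-≗ (λ r → sum-cong-≗ λ c → trans (sum-*ˡ (u r) (λ l → v c * w l (L r c))) (cong (u r *_)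
           (trans (sum-*ˡ (v c) (λ l → w l (L r c))) (trans (cong (v c *_) (Σw≡1 (L r c))) (ℕ.*-identityʳ _))))) ⟩
    sum (λ r → sum λ c → u r * v c)              ≡⟨ sum-cong-≗ (λ r → sum-*ˡ (u r) v) ⟩
    sum (λ r → u r * sum v)                      ≡⟨ sum-*ʳ u (sum v) ⟩
    sum u * sum v                                ∎

  cellSum-vanishes : ∀ (U V W : Subset n) → (∀ r c → r ∈ U → c ∈ V → L r c ∈ W → ⊥) →
                     cellSum (ind U) (ind V) (ind W) ≡ 0
  cellSum-vanishes U V W empty = sum-zero _ λ r → sum-zero _ λ c → cell r c
    where
    cell : ∀ r c → ind U r * (ind V c * ind W (L r c)) ≡ 0
    cell r c with r ∈? U | c ∈? V | L r c ∈? W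
    ... | no _    | _       | _       = refl
    ... | yes _   | no _    | _       = refl
    ... | yes _   | yes _   | no _    = refl
    ... | yes r∈U | yes c∈V | yes s∈W = ⊥-elim (empty r c r∈U c∈V s∈W)

record IsBlockCount {k} (p : Fin k → ℕ) (A : Fin k → Fin k → Fin k → ℕ) : Set where
  field
    marginal₁   : ∀ i j → sum (λ l → A l i j) ≡ p i * p j
    marginal₂   : ∀ i j → sum (λ l → A i l j) ≡ p i * p j
    marginal₃   : ∀ i j → sum (λ l → A i j l) ≡ p i * p j
    vanishing₁₂ : ∀ i j → i ≢ j → A i i j ≡ 0
    vanishing₁₃ : ∀ i j → i ≢ j → A i j i ≡ 0
    vanishing₂₃ : ∀ i j → i ≢ j → A j i i ≡ 0

module BlockCount {k} (p : Fin k → ℕ) {n} (L : Fin n → Fin n → Fin n) (lat : IsLatinSquare L)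
  (R C S : Fin k → Subset n) (subsquare : ∀ i → IsSubsquare L (p i) (R i) (C i) (S i))
  (disjoint : ∀ i j → i ≢ j → DisjointSets (R i) (R j) × DisjointSets (C i) (C j) × DisjointSets (S i) (S j))
  (total : sum p ≡ n)
  where

  open CellSum L lat

  count : Fin k → Fin k → Fin k → ℕ
  count i j l = cellSum (ind (R i)) (ind (C j)) (ind (S l))

  private
    size : ∀ (F : Fin k → Subset n) → (∀ i → ∣ F i ∣ ≡ p i) → ∀ i → sum (ind (F i)) ≡ p i
    size F |F|≡p i = trans (sum-ind (F i)) (|F|≡p i)

    covers : ∀ (F : Fin k → Subset n) → (∀ i → ∣ F i ∣ ≡ p i) → (∀ i j → i ≢ j → DisjointSets (F i) (F j)) →
             ∀ x → sum (λ l → ind (F l) x) ≡ 1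
    covers F |F|≡p disjointF = sum-ind-partition≡1 F disjointF (trans (sum-cong-≗ |F|≡p) total)

    |R|≡p : ∀ i → ∣ R i ∣ ≡ p i
    |R|≡p i = proj₁ (subsquare i)

    |C|≡p : ∀ i → ∣ C i ∣ ≡ p i
    |C|≡p i = proj₁ (proj₂ (subsquare i))

    |S|≡p : ∀ i → ∣ S i ∣ ≡ p i
    |S|≡p i = proj₁ (proj₂ (proj₂ (subsquare i)))

    closed : ∀ i {r c} → r ∈ R i → c ∈ C i → L r c ∈ S i
    closed i = proj₁ (proj₂ (proj₂ (proj₂ (subsquare i)))) _ _

    row-closed : ∀ i {r s} → r ∈ R i → s ∈ S i → ∃ λ c → c ∈ C i × L r c ≡ s
    row-closed i r∈ s∈ = let (c , c∈ , Lrc≡s , _) = proj₁ (proj₂ (proj₂ (proj₂ (proj₂ (subsquare i))))) _ _ r∈ s∈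
                         in c , c∈ , Lrc≡s

    column-closed : ∀ i {c s} → c ∈ C i → s ∈ S i → ∃ λ r → r ∈ R i × L r c ≡ s
    column-closed i c∈ s∈ = let (r , r∈ , Lrc≡s , _) = proj₂ (proj₂ (proj₂ (proj₂ (proj₂ (subsquare i))))) _ _ c∈ s∈
                            in r , r∈ , Lrc≡s

  count-isBlockCount : IsBlockCount p count
  count-isBlockCount = record
    { marginal₁   = λ i j → trans (cellSum-marginal₁ (ind ∘ R) _ _ (covers R |R|≡p λ i j → proj₁ ∘ disjoint i j))
                                  (cong₂ _*_ (size C |C|≡p i) (size S |S|≡p j))
    ; marginal₂   = λ i j → trans (cellSum-marginal₂ _ (ind ∘ C) _ (covers C |C|≡p λ i j → proj₁ ∘ proj₂ ∘ disjoint i j))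
                                  (cong₂ _*_ (size R |R|≡p i) (size S |S|≡p j))
    ; marginal₃   = λ i j → trans (cellSum-marginal₃ _ _ (ind ∘ S) (covers S |S|≡p λ i j → proj₂ ∘ proj₂ ∘ disjoint i j))
                                  (cong₂ _*_ (size R |R|≡p i) (size C |C|≡p j))
    ; vanishing₁₂ = λ i j i≢j → cellSum-vanishes _ _ _ λ r c r∈Rᵢ c∈Cᵢ s∈Sⱼ →
                      proj₂ (proj₂ (disjoint i j i≢j)) (L r c) (closed i r∈Rᵢ c∈Cᵢ) s∈Sⱼ
    ; vanishing₁₃ = λ i j i≢j → cellSum-vanishes _ _ _ λ r c r∈Rᵢ c∈Cⱼ s∈Sᵢ →
                      let (c′ , c′∈Cᵢ , Lrc′≡Lrc) = row-closed i r∈Rᵢ s∈Sᵢ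
                      in proj₁ (proj₂ (disjoint i j i≢j)) c (subst (_∈ C i) (row-injective r Lrc′≡Lrc) c′∈Cᵢ) c∈Cⱼ
    ; vanishing₂₃ = λ i j i≢j → cellSum-vanishes _ _ _ λ r c r∈Rⱼ c∈Cᵢ s∈Sᵢ →
                      let (r′ , r′∈Rᵢ , Lr′c≡Lrc) = column-closed i c∈Cᵢ s∈Sᵢ
                      in proj₁ (disjoint i j i≢j) r (subst (_∈ R i) (column-injective c Lr′c≡Lrc) r′∈Rᵢ) r∈Rⱼ
    }

LS⇒blockCount : ∀ {k} {p : Fin k → ℕ} → LS p → ∃ (IsBlockCount p)
LS⇒blockCount {p = p} (L , lat , R , C , S , subsquare , disjoint) = count , count-isBlockCount
  where open BlockCount p L lat R C S subsquare disjoint (sym (sumℕ≡sum p))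

-- A / D is an ROS. No diagonal field is needed: once the entries A i i j with j ≢ i vanish,
-- A i i i is the whole marginal sum (A i i).
record IsIntegralROS {k} (D : ℕ) (p : Fin k → ℕ) (A : Fin k → Fin k → Fin k → ℕ) : Set where
  field
    symmetric : ∀ i j l → (A i j l ≡ A j i l) × (A i j l ≡ A i l j)
    marginal  : ∀ i j → sum (A i j) ≡ D * (p i * p j)
    vanishing : ∀ i j → i ≢ j → A i i j ≡ 0

module _ {k : ℕ} where

  cyclic : (Fin k → Fin k → Fin k → ℕ) → Fin k → Fin k → Fin k → ℕ
  cyclic A i j l = A i j l + A j l i + A l i j

  symmetrize : (Fin k → Fin k → Fin k → ℕ) → Fin k → Fin k → Fin k → ℕ
  symmetrize A i j l = cyclic A i j l + cyclic A j i l

  symmetrize-isIntegralROS : ∀ {p A} → IsBlockCount p A → IsIntegralROS 6 p (symmetrize A)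
  symmetrize-isIntegralROS {p} {A} isA = record
    { symmetric = λ i j l → ℕ.+-comm (cyclic A i j l) (cyclic A j i l) , symmetric₂₃ i j l
    ; marginal  = marginal
    ; vanishing = λ i j i≢j → cong₂ _+_ (cyclic≡0 i j i≢j) (cyclic≡0 i j i≢j)
    }
    where
    open IsBlockCount isA

    symmetric₂₃ : ∀ i j l → symmetrize A i j l ≡ symmetrize A i l j
    symmetric₂₃ i j l = rearrange (A i j l) (A j l i) (A l i j) (A j i l) (A i l j) (A l j i)
      where
      rearrange : ∀ a b c d e f → a + b + c + (d + e + f) ≡ e + f + d + (c + a + b)
      rearrange = solve-∀

    cyclic≡0 : ∀ i j → i ≢ j → cyclic A i i j ≡ 0
    cyclic≡0 i j i≢j rewrite vanishing₁₂ i j i≢j | vanishing₁₃ i j i≢j | vanishing₂₃ i j i≢j = refl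

    ∑-cyclic : ∀ i j → sum (cyclic A i j) ≡ p i * p j + p j * p i + p i * p j
    ∑-cyclic i j = begin
      sum (cyclic A i j)                                       ≡⟨ ∑-distrib-+ (λ l → A i j l + A j l i) (λ l → A l i j) ⟩
      sum (λ l → A i j l + A j l i) + sum (λ l → A l i j)
        ≡⟨ cong (_+ sum (λ l → A l i j)) (∑-distrib-+ (A i j) (λ l → A j l i)) ⟩
      sum (A i j) + sum (λ l → A j l i) + sum (λ l → A l i j)
        ≡⟨ cong₂ _+_ (cong₂ _+_ (marginal₃ i j) (marginal₂ j i)) (marginal₁ i j) ⟩
      p i * p j + p j * p i + p i * p j                        ∎

    marginal : ∀ i j → sum (symmetrize A i j) ≡ 6 * (p i * p j)
    marginal i j = begin
      sum (symmetrize A i j)                   ≡⟨ ∑-distrib-+ (cyclic A i j) (cyclic A j i) ⟩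
      sum (cyclic A i j) + sum (cyclic A j i)  ≡⟨ cong₂ _+_ (∑-cyclic i j) (∑-cyclic j i) ⟩
      p i * p j + p j * p i + p i * p j + (p j * p i + p i * p j + p j * p i) ≡⟨ six (p i) (p j) ⟩
      6 * (p i * p j)                          ∎
      where
      six : ∀ x y → x * y + y * x + x * y + (y * x + x * y + y * x) ≡ 6 * (x * y)
      six = solve-∀

module _ {k : ℕ} where

  transpose-matchˡ : ∀ (α β : Fin k) → transpose α β α ≡ β
  transpose-matchˡ α β rewrite dec-true (α ≟ α) refl = refl

  transpose-other : ∀ {α β x : Fin k} → x ≢ α → x ≢ β → transpose α β x ≡ x
  transpose-other {α} {β} {x} x≢α x≢β rewrite dec-false (x ≟ α) x≢α | dec-false (x ≟ β) x≢β = refl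

  transpose-injective : ∀ (α β : Fin k) {x y} → transpose α β x ≡ transpose α β y → x ≡ y
  transpose-injective α β e = trans (sym (transpose-inverse β α)) (trans (cong (transpose β α) e) (transpose-inverse β α))

  transpose-closed : ∀ (M : Fin k → Set) {α β x} → M α → M β → M x → M (transpose α β x)
  transpose-closed M {α} {β} {x} Mα Mβ Mx with x ≟ α
  ... | yes _ = Mβ
  ... | no _ with x ≟ β
  ...   | yes _ = Mα
  ...   | no _  = Mx

  transpose-preserves : ∀ (p : Fin k → ℕ) {α β} → p α ≡ p β → ∀ x → p (transpose α β x) ≡ p x
  transpose-preserves p {α} {β} pα≡pβ x with x ≟ α
  ... | yes refl = sym pα≡pβ
  ... | no _ with x ≟ β
  ...   | yes refl = pα≡pβ
  ...   | no _     = refl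

funToFin-cong : ∀ {m n} {f g : Fin m → Fin n} → f ≗ g → funToFin f ≡ funToFin g
funToFin-cong {zero}  f≗g = refl
funToFin-cong {suc m} f≗g = cong₂ combine (f≗g zero) (funToFin-cong (f≗g ∘ suc))

module Averaging {k : ℕ} (p : Fin k → ℕ) where

  IsPartPermutation : (Fin k → Fin k) → Set
  IsPartPermutation g = (∀ x y → g x ≡ g y → x ≡ y) × (∀ y → ∃ λ x → g x ≡ y) × (∀ x → p (g x) ≡ p x)

  isPartPermutation? : ∀ g → Dec (IsPartPermutation g)
  isPartPermutation? g = all? (λ x → all? λ y → (g x ≟ g y) →-dec (x ≟ y))
                   ×-dec all? (λ y → any? λ x → g x ≟ y)
                   ×-dec all? (λ x → p (g x) ℕ.≟ p x)

  id-isPartPermutation : IsPartPermutation id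
  id-isPartPermutation = (λ _ _ x≡y → x≡y) , (λ y → y , refl) , (λ _ → refl)

  ∘-isPartPermutation : ∀ {g h} → IsPartPermutation g → IsPartPermutation h → IsPartPermutation (g ∘ h)
  ∘-isPartPermutation {g} (g-inj , g-surj , g-pres) (h-inj , h-surj , h-pres) =
    (λ x y e → h-inj x y (g-inj _ _ e)) ,
    (λ z → let (y , gy≡z) = g-surj z ; (x , hx≡y) = h-surj y in x , trans (cong g hx≡y) gy≡z) ,
    (λ x → trans (g-pres _) (h-pres x))

  ≗-isPartPermutation : ∀ {g h} → g ≗ h → IsPartPermutation g → IsPartPermutation h
  ≗-isPartPermutation g≗h (g-inj , g-surj , g-pres) =
    (λ x y e → g-inj x y (trans (g≗h x) (trans e (sym (g≗h y))))) ,
    (λ y → let (x , gx≡y) = g-surj y in x , trans (sym (g≗h x)) gx≡y) ,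
    (λ x → trans (cong p (sym (g≗h x))) (g-pres x))

  transpose-isPartPermutation : ∀ {α β} → p α ≡ p β → IsPartPermutation (transpose α β)
  transpose-isPartPermutation {α} {β} pα≡pβ =
    (λ _ _ → transpose-injective α β) , (λ y → transpose β α y , transpose-inverse α β) , transpose-preserves p pα≡pβ

  module Inverse {h} (h-isPartPermutation : IsPartPermutation h) where

    h⁻¹ : Fin k → Fin k
    h⁻¹ y = proj₁ (proj₁ (proj₂ h-isPartPermutation) y)

    inverseʳ : ∀ y → h (h⁻¹ y) ≡ y
    inverseʳ y = proj₂ (proj₁ (proj₂ h-isPartPermutation) y)

    inverseˡ : ∀ x → h⁻¹ (h x) ≡ x
    inverseˡ x = proj₁ h-isPartPermutation _ _ (inverseʳ (h x))

    h⁻¹-isPartPermutation : IsPartPermutation h⁻¹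
    h⁻¹-isPartPermutation =
      (λ x y e → trans (sym (inverseʳ x)) (trans (cong h e) (inverseʳ y))) ,
      (λ x → h x , inverseˡ x) ,
      (λ y → trans (sym (proj₂ (proj₂ h-isPartPermutation) (h⁻¹ y))) (cong p (inverseʳ y)))

  sum-∘-isPartPermutation : ∀ {g} → IsPartPermutation g → (f : Fin k → ℕ) → sum (f ∘ g) ≡ sum f
  sum-∘-isPartPermutation g-isPartPermutation f = sym (∑-permute f (permutation _ h⁻¹ inverseʳ inverseˡ))
    where open Inverse g-isPartPermutation

  -- Sums over the group of part permutations run over the codes of all maps Fin k → Fin k,
  -- with weight selecting the group.
  encode : (Fin k → Fin k) → Fin (k ^ k)
  encode = funToFin

  decode : Fin (k ^ k) → Fin k → Fin k
  decode = finToFun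

  weight : Fin (k ^ k) → ℕ
  weight c = χ (isPartPermutation? (decode c))

  order : ℕ
  order = sum weight

  order≢0 : NonZero order
  order≢0 = ℕ.>-nonZero $ ℕ.≤-trans (ℕ.≤-reflexive (sym weight-id≡1)) (term≤sum weight (encode id))
    where
    weight-id≡1 : weight (encode id) ≡ 1
    weight-id≡1 = cong (λ b → if b then 1 else 0) (dec-true (isPartPermutation? _)
      (≗-isPartPermutation (λ x → sym (finToFun-funToFin {k} {k} id x)) id-isPartPermutation))

  average : (Fin k → Fin k → Fin k → ℕ) → Fin k → Fin k → Fin k → ℕ
  average F i j l = sum λ c → let g = decode c in weight c * F (g i) (g j) (g l)

  ∑-weight-const : ∀ (f : (Fin k → Fin k) → ℕ) {v} → (∀ g → IsPartPermutation g → f g ≡ v) →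
                   sum (λ c → weight c * f (decode c)) ≡ order * v
  ∑-weight-const f {v} f≡v = trans (sum-cong-≗ λ c → χ-cong (isPartPermutation? (decode c)) (f≡v (decode c)))
                                   (sym (*-distribʳ-sum v weight))

  average-isIntegralROS : ∀ {D F} → IsIntegralROS D p F → IsIntegralROS (order * D) p (average F)
  average-isIntegralROS {D} {F} isF = record
    { symmetric = λ i j l → sum-cong-≗ (λ c → cong (weight c *_) (proj₁ (symmetric _ _ _))) ,
                            sum-cong-≗ (λ c → cong (weight c *_) (proj₂ (symmetric _ _ _)))
    ; marginal  = average-marginal
    ; vanishing = λ i j i≢j → trans (∑-weight-const (λ g → F (g i) (g i) (g j))
                                       λ g (g-inj , _) → vanishing _ _ (i≢j ∘ g-inj i j))
                                    (ℕ.*-zeroʳ order)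
    }
    where
    open IsIntegralROS isF

    marginal-∘ : ∀ i j g → IsPartPermutation g → sum (λ l → F (g i) (g j) (g l)) ≡ D * (p i * p j)
    marginal-∘ i j g g-isPartPermutation@(_ , _ , g-pres) = begin
      sum (λ l → F (g i) (g j) (g l)) ≡⟨ sum-∘-isPartPermutation g-isPartPermutation (F (g i) (g j)) ⟩
      sum (F (g i) (g j))             ≡⟨ marginal (g i) (g j) ⟩
      D * (p (g i) * p (g j))         ≡⟨ cong₂ (λ x y → D * (x * y)) (g-pres i) (g-pres j) ⟩
      D * (p i * p j)                 ∎

    average-marginal : ∀ i j → sum (average F i j) ≡ order * D * (p i * p j)
    average-marginal i j = begin
      sum (average F i j)
        ≡⟨ ∑-comm (λ l c → let g = decode c in weight c * F (g i) (g j) (g l)) ⟩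
      sum (λ c → let g = decode c in sum λ l → weight c * F (g i) (g j) (g l))
        ≡⟨ sum-cong-≗ (λ c → let g = decode c in sum-*ˡ (weight c) λ l → F (g i) (g j) (g l)) ⟩
      sum (λ c → let g = decode c in weight c * sum λ l → F (g i) (g j) (g l))
        ≡⟨ ∑-weight-const (λ g → sum λ l → F (g i) (g j) (g l)) (marginal-∘ i j) ⟩
      order * (D * (p i * p j))
        ≡⟨ ℕ.*-assoc order D (p i * p j) ⟨
      order * D * (p i * p j) ∎

  act : (Fin k → Fin k) → Fin (k ^ k) → Fin (k ^ k)
  act f c = encode (decode c ∘ f)

  decode-act : ∀ f c → decode (act f c) ≗ decode c ∘ f
  decode-act f c = finToFun-funToFin (decode c ∘ f)

  act-∘ : ∀ f g c → act f (act g c) ≡ act (g ∘ f) c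
  act-∘ f g c = funToFin-cong λ x → decode-act g c (f x)

  act-id : ∀ {f} → f ≗ id → ∀ c → act f c ≡ c
  act-id f≗id c = trans (funToFin-cong λ x → cong (decode c) (f≗id x)) (funToFin-finToFin {k} {k} c)

  weight-act : ∀ {h} → IsPartPermutation h → ∀ c → weight (act h c) ≡ weight c
  weight-act {h} h-isPartPermutation c = χ-⇔ (isPartPermutation? _) (isPartPermutation? _)
    (λ gh-isPP → ≗-isPartPermutation (λ y → trans (decode-act h c (h⁻¹ y)) (cong (decode c) (inverseʳ y)))
                                     (∘-isPartPermutation gh-isPP h⁻¹-isPartPermutation))
    (λ g-isPP → ≗-isPartPermutation (λ x → sym (decode-act h c x)) (∘-isPartPermutation g-isPP h-isPartPermutation))
    where open Inverse h-isPartPermutation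

  average-invariant : ∀ {h} → IsPartPermutation h → ∀ F i j l → average F (h i) (h j) (h l) ≡ average F i j l
  average-invariant {h} h-isPartPermutation F i j l = begin
    average F (h i) (h j) (h l)  ≡⟨ sum-cong-≗ term-act ⟨
    sum (term ∘ act h)           ≡⟨ ∑-permute term (permutation (act h) (act h⁻¹) act-h-h⁻¹ act-h⁻¹-h) ⟨
    average F i j l              ∎
    where
    open Inverse h-isPartPermutation

    term : Fin (k ^ k) → ℕ
    term c = let g = decode c in weight c * F (g i) (g j) (g l)

    term-act : ∀ c → term (act h c) ≡ let g = decode c in weight c * F (g (h i)) (g (h j)) (g (h l))
    term-act c rewrite weight-act h-isPartPermutation c | decode-act h c i | decode-act h c j | decode-act h c l = refl

    act-h-h⁻¹ : ∀ c → act h (act h⁻¹ c) ≡ c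
    act-h-h⁻¹ c = trans (act-∘ h h⁻¹ c) (act-id inverseˡ c)

    act-h⁻¹-h : ∀ c → act h⁻¹ (act h c) ≡ c
    act-h⁻¹-h c = trans (act-∘ h⁻¹ h c) (act-id inverseʳ c)

fromℚᵘ-homo-+ : ∀ x y → fromℚᵘ (x ℚᵘ.+ y) ≡ fromℚᵘ x ℚ.+ fromℚᵘ y
fromℚᵘ-homo-+ x y = ℚ.toℚᵘ-injective (ℚᵘ.≃-trans (ℚ.toℚᵘ-fromℚᵘ (x ℚᵘ.+ y))
  (ℚᵘ.≃-sym (ℚᵘ.≃-trans (ℚ.toℚᵘ-homo-+ (fromℚᵘ x) (fromℚᵘ y))
                        (ℚᵘ.+-cong (ℚ.toℚᵘ-fromℚᵘ x) (ℚ.toℚᵘ-fromℚᵘ y)))))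

+-distrib-/ : ∀ {D} .{{_ : NonZero D}} a b → (+ (a + b)) / D ≡ (+ a) / D ℚ.+ (+ b) / D
+-distrib-/ {suc d} a b =
  trans (ℚ.fromℚᵘ-cong {mkℚᵘ (+ (a + b)) d} {mkℚᵘ (+ a) d ℚᵘ.+ mkℚᵘ (+ b) d} (*≡* cross))
        (fromℚᵘ-homo-+ (mkℚᵘ (+ a) d) (mkℚᵘ (+ b) d))
  where
  cross : + (a + b) ℤ.* (+ suc d ℤ.* + suc d) ≡ (+ a ℤ.* + suc d ℤ.+ + b ℤ.* + suc d) ℤ.* + suc d
  cross = begin
    + (a + b) ℤ.* (+ suc d ℤ.* + suc d)                ≡⟨ cong (ℤ._* (+ suc d ℤ.* + suc d)) (ℤ.pos-+ a b) ⟩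
    (+ a ℤ.+ + b) ℤ.* (+ suc d ℤ.* + suc d)            ≡⟨ ℤ.*-assoc (+ a ℤ.+ + b) (+ suc d) (+ suc d) ⟨
    (+ a ℤ.+ + b) ℤ.* + suc d ℤ.* + suc d              ≡⟨ cong (ℤ._* + suc d) (ℤ.*-distribʳ-+ (+ suc d) (+ a) (+ b)) ⟩
    (+ a ℤ.* + suc d ℤ.+ + b ℤ.* + suc d) ℤ.* + suc d  ∎

sum-distrib-/ : ∀ {k D} .{{_ : NonZero D}} (f : Fin k → ℕ) → sumℚ (λ l → (+ f l) / D) ≡ (+ sum f) / D
sum-distrib-/ {zero}  {D} f = sym (ℚ.0/n≡0 D)
sum-distrib-/ {suc k} {D} f = trans (cong (λ q → (+ f zero) / D ℚ.+ q) (sum-distrib-/ (f ∘ suc)))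
                                    (sym (+-distrib-/ (f zero) (sum (f ∘ suc))))

*-cancelˡ-/ : ∀ {D} .{{_ : NonZero D}} c → (+ (D * c)) / D ≡ ℕ→ℚ c
*-cancelˡ-/ {suc d} c = ℚ.fromℚᵘ-cong {mkℚᵘ (+ (suc d * c)) d} {mkℚᵘ (+ c) 0} (*≡* cross)
  where
  cross : + (suc d * c) ℤ.* + 1 ≡ + c ℤ.* + suc d
  cross = trans (ℤ.*-identityʳ (+ (suc d * c))) (trans (ℤ.pos-* (suc d) c) (ℤ.*-comm (+ suc d) (+ c)))

isROS-/ : ∀ {k D p A} .{{_ : NonZero D}} → IsIntegralROS {k} D p A → IsROS p (λ i j l → (+ A i j l) / D)
isROS-/ {D = D} {p} {A} isA =
  (λ i j l → cong /D (proj₁ (symmetric i j l)) , cong /D (proj₂ (symmetric i j l))) ,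
  (λ i j l → ℚ.nonNegative⁻¹ _ {{ℚ.normalize-nonNeg (A i j l) D}}) ,
  (λ i j → trans (sum-distrib-/ (A i j)) (trans (cong /D (marginal i j)) (*-cancelˡ-/ (p i * p j)))) ,
  (λ i → trans (cong /D (diagonal i)) (*-cancelˡ-/ (p i * p i))) ,
  (λ i j i≢j → trans (cong /D (vanishing i j i≢j)) (ℚ.0/n≡0 D))
  where
  open IsIntegralROS isA

  /D : ℕ → ℚ
  /D a = (+ a) / D

  diagonal : ∀ i → A i i i ≡ D * (p i * p i)
  diagonal i = trans (sym (sum-single (A i i) i λ j j≢i → vanishing i j (j≢i ∘ sym))) (marginal i i)

module _ {A B : Set} {P : A → Set} where

  pick : Dec (∃ P) → B → (A → B) → B
  pick (yes (x , _)) _ f = f x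
  pick (no _)        b _ = b

  pick-preserves : ∀ (Q : B → Set) (d : Dec (∃ P)) {b f} → Q b → (∀ x → Q (f x)) → Q (pick d b f)
  pick-preserves Q (yes (x , _)) _  Qf = Qf x
  pick-preserves Q (no _)        Qb _  = Qb

  pick-const : ∀ (d : Dec (∃ P)) {b f} → (∀ {x y} → P x → P y → f x ≡ f y) → ∀ {x} → P x → f x ≡ pick d b f
  pick-const (yes (y , Py)) f-const Px = f-const Px Py
  pick-const (no ∄P)        _       Px = ⊥-elim (∄P (_ , Px))

module _ {k : ℕ} where

  any²? : {R : Fin k → Fin k → Set} → (∀ x y → Dec (R x y)) → Dec (∃ λ ((x , y) : Fin k × Fin k) → R x y)
  any²? R? = map′ (λ (x , y , r) → (x , y) , r) (λ ((x , y) , r) → x , y , r) (any? λ x → any? (R? x))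

  any³? : {R : Fin k → Fin k → Fin k → Set} → (∀ x y z → Dec (R x y z)) →
          Dec (∃ λ ((x , y , z) : Fin k × Fin k × Fin k) → R x y z)
  any³? R? = map′ (λ (x , (y , z) , r) → (x , y , z) , r) (λ ((x , y , z) , r) → x , (y , z) , r)
                  (any? λ x → any²? (R? x))

  inBlock? : ∀ a m → Decidable (InBlock {k} a m)
  inBlock? a m x = a ≤? toℕ x ×-dec toℕ x <? a + m

module Similarity {k : ℕ} (X : Fin k → Fin k → Fin k → ℚ) {M : Fin k → Set} (M? : Decidable M)
  (invariant : ∀ {α β} → M α → M β → ∀ i j l → X (transpose α β i) (transpose α β j) (transpose α β l) ≡ X i j l)
  where

  Distinct₂ : Fin k → Fin k → Set
  Distinct₂ α β = M α × M β × α ≢ β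

  Distinct₃ : Fin k → Fin k → Fin k → Set
  Distinct₃ α β γ = M α × M β × M γ × α ≢ β × α ≢ γ × β ≢ γ

  private
    τ : Fin k → Fin k → Fin k → Fin k
    τ = transpose

    moves : ∀ {α β i j l i′ j′ l′} → M α → M β →
            τ α β i ≡ i′ → τ α β j ≡ j′ → τ α β l ≡ l′ → X i j l ≡ X i′ j′ l′
    moves Mα Mβ refl refl refl = sym (invariant Mα Mβ _ _ _)

    fixes : ∀ {α β x} → M α → M β → ¬ M x → τ α β x ≡ x
    fixes Mα Mβ ¬Mx = transpose-other (λ { refl → ¬Mx Mα }) (λ { refl → ¬Mx Mβ })

    τ-≢ : ∀ {α β x y} → x ≢ y → τ α β x ≢ τ α β y
    τ-≢ {α} {β} x≢y e = x≢y (transpose-injective α β e)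

  X-const₁ : ∀ {i j α α′} → ¬ M i → ¬ M j → M α → M α′ → X i j α ≡ X i j α′
  X-const₁ {α = α} {α′} ¬Mi ¬Mj Mα Mα′ =
    moves Mα Mα′ (fixes Mα Mα′ ¬Mi) (fixes Mα Mα′ ¬Mj) (transpose-matchˡ α α′)

  -- Each step transposes the next coordinate into place while fixing those already placed.
  X-const₂ : ∀ {i α β α′ β′} → ¬ M i → Distinct₂ α β → Distinct₂ α′ β′ → X i α β ≡ X i α′ β′
  X-const₂ {i} {α} {β} {α′} {β′} ¬Mi (Mα , Mβ , α≢β) (Mα′ , Mβ′ , α′≢β′) = begin
    X i α β   ≡⟨ moves Mα Mα′ (fixes Mα Mα′ ¬Mi) (transpose-matchˡ α α′) refl ⟩
    X i α′ β₁ ≡⟨ moves Mβ₁ Mβ′ (fixes Mβ₁ Mβ′ ¬Mi) (transpose-other α′≢β₁ α′≢β′) (transpose-matchˡ β₁ β′) ⟩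
    X i α′ β′ ∎
    where
    β₁ : Fin k
    β₁ = τ α α′ β

    Mβ₁ : M β₁
    Mβ₁ = transpose-closed M Mα Mα′ Mβ

    α′≢β₁ : α′ ≢ β₁
    α′≢β₁ = subst (_≢ β₁) (transpose-matchˡ α α′) (τ-≢ α≢β)

  X-const₃ : ∀ {α β γ α′ β′ γ′} → Distinct₃ α β γ → Distinct₃ α′ β′ γ′ → X α β γ ≡ X α′ β′ γ′
  X-const₃ {α} {β} {γ} {α′} {β′} {γ′}
           (Mα , Mβ , Mγ , α≢β , α≢γ , β≢γ) (Mα′ , Mβ′ , Mγ′ , α′≢β′ , α′≢γ′ , β′≢γ′) = begin
    X α β γ     ≡⟨ moves Mα Mα′ (transpose-matchˡ α α′) refl refl ⟩
    X α′ β₁ γ₁  ≡⟨ moves Mβ₁ Mβ′ (transpose-other α′≢β₁ α′≢β′) (transpose-matchˡ β₁ β′) refl ⟩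
    X α′ β′ γ₂  ≡⟨ moves Mγ₂ Mγ′ (transpose-other α′≢γ₂ α′≢γ′) (transpose-other β′≢γ₂ β′≢γ′) (transpose-matchˡ γ₂ γ′) ⟩
    X α′ β′ γ′  ∎
    where
    β₁ γ₁ γ₂ : Fin k
    β₁ = τ α α′ β
    γ₁ = τ α α′ γ
    γ₂ = τ β₁ β′ γ₁

    Mβ₁ : M β₁
    Mβ₁ = transpose-closed M Mα Mα′ Mβ

    Mγ₂ : M γ₂
    Mγ₂ = transpose-closed M Mβ₁ Mβ′ (transpose-closed M Mα Mα′ Mγ)

    α′≢β₁ : α′ ≢ β₁
    α′≢β₁ = subst (_≢ β₁) (transpose-matchˡ α α′) (τ-≢ α≢β)

    α′≢γ₁ : α′ ≢ γ₁
    α′≢γ₁ = subst (_≢ γ₁) (transpose-matchˡ α α′) (τ-≢ α≢γ)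

    α′≢γ₂ : α′ ≢ γ₂
    α′≢γ₂ = subst (_≢ γ₂) (transpose-other α′≢β₁ α′≢β′) (τ-≢ α′≢γ₁)

    β′≢γ₂ : β′ ≢ γ₂
    β′≢γ₂ = subst (_≢ γ₂) (transpose-matchˡ β₁ β′) (τ-≢ (τ-≢ β≢γ))

  similarWrt : (∀ i j l → 0ℚ ℚ.≤ X i j l) → SimilarWrt X M
  similarWrt X≥0 =
    (λ i j → pick ∃₁ 0ℚ (X i j)) , (λ i → pick ∃₂ 0ℚ λ (α , β) → X i α β) , pick ∃₃ 0ℚ (λ (α , β , γ) → X α β γ) ,
    (λ i j → pick-preserves (0ℚ ℚ.≤_) ∃₁ ℚ.≤-refl (X≥0 i j)) ,
    (λ i → pick-preserves (0ℚ ℚ.≤_) ∃₂ ℚ.≤-refl λ (α , β) → X≥0 i α β) ,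
    pick-preserves (0ℚ ℚ.≤_) ∃₃ ℚ.≤-refl (λ (α , β , γ) → X≥0 α β γ) ,
    (λ i j α ¬Mi ¬Mj Mα → pick-const ∃₁ (X-const₁ ¬Mi ¬Mj) Mα) ,
    (λ i α β ¬Mi Mα Mβ α≢β → pick-const ∃₂ (X-const₂ ¬Mi) (Mα , Mβ , α≢β)) ,
    (λ α β γ Mα Mβ Mγ α≢β α≢γ β≢γ → pick-const ∃₃ X-const₃ (Mα , Mβ , Mγ , α≢β , α≢γ , β≢γ))
    where
    ∃₁ : Dec (∃ M)
    ∃₁ = any? M?

    ∃₂ : Dec (∃ λ ((α , β) : Fin k × Fin k) → Distinct₂ α β)
    ∃₂ = any²? λ α β → M? α ×-dec M? β ×-dec ¬? (α ≟ β)

    ∃₃ : Dec (∃ λ ((α , β , γ) : Fin k × Fin k × Fin k) → Distinct₃ α β γ)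
    ∃₃ = any³? λ α β γ → M? α ×-dec M? β ×-dec M? γ ×-dec ¬? (α ≟ β) ×-dec ¬? (α ≟ γ) ×-dec ¬? (β ≟ γ)

mainTheorem14 : (k : ℕ) (p : Fin k → ℕ) → (∀ i → 1 ≤ p i) →
    (t : ℕ) (a m : Fin t → ℕ) →
    (∀ s → a s + m s ≤ k) →
    (∀ s s' → s ≢ s' → ∀ (x : Fin k) → InBlock (a s) (m s) x → InBlock (a s') (m s') x → ⊥) →
    (∀ s (x y : Fin k) → InBlock (a s) (m s) x → InBlock (a s) (m s) y → p x ≡ p y) →
    LS p →
    Σ (Fin k → Fin k → Fin k → ℚ) λ X →
      IsROS p X × (∀ s → SimilarWrt X (InBlock (a s) (m s)))
mainTheorem14 k p _ t a m _ _ p-const ls =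
  X , X-isROS , λ s → Similarity.similarWrt X (inBlock? (a s) (m s)) (X-invariant s) (proj₁ (proj₂ X-isROS))
  where
  open Averaging p

  B : Fin k → Fin k → Fin k → ℕ
  B = symmetrize (proj₁ (LS⇒blockCount ls))

  instance
    order*6≢0 : NonZero (order * 6)
    order*6≢0 = ℕ.m*n≢0 order 6 {{order≢0}}

  X : Fin k → Fin k → Fin k → ℚ
  X i j l = (+ average B i j l) / (order * 6)

  X-isROS : IsROS p X
  X-isROS = isROS-/ (average-isIntegralROS (symmetrize-isIntegralROS (proj₂ (LS⇒blockCount ls))))

  X-invariant : ∀ s {α β} → InBlock (a s) (m s) α → InBlock (a s) (m s) β →
                ∀ i j l → X (transpose α β i) (transpose α β j) (transpose α β l) ≡ X i j l
  X-invariant s Mα Mβ i j l = cong (λ n → (+ n) / (order * 6))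
    (average-invariant (transpose-isPartPermutation (p-const s _ _ Mα Mβ)) B i j l)
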